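{- For every integer $k\ge 0$ and nonnegative integers $r_0=1,r_1,\ldots,r_k$ with $r_k>0$, there exists a connected graph $G$ such that $\mu_{\rm d}(G)=k$ and the dual visibility spectrum of $G$ is $(1,r_1,\ldots,r_k)$.
   Context: All graphs are finite, simple and connected. For a graph $G$ and $X\subseteq V(G)$, two vertices $x,y$ are $X$-visible if there is a shortest $x,y$-path in $G$ with no internal vertex in $X$. $X$ is a dual mutual-visibility set if any two vertices of $X$ are $X$-visible and any two vertices of $V(G)\setminus X$ are $X$-visible. $\mu_{\rm d}(G)$ is the maximum cardinality of a dual mutual-visibility set. The dual visibility spectrum of $G$ is the vector $(r_0,\ldots,r_k)$ with $k=\mu_{\rm d}(G)$, where $r_i$ is the number of distinct dual mutual-visibility sets of $G$ of cardinality $i$ (so $r_0=1$, the empty set). -}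

module Defs where

open import Data.Nat using (ℕ; zero; suc; _≤_; _<_)
open import Data.Fin using (Fin; toℕ; fromℕ)
open import Data.Fin.Subset using (Subset; _∈_; _∉_; ∣_∣)
open import Data.Product using (Σ; ∃; _×_; _,_)
open import Data.Unit using (⊤)
open import Data.Empty using (⊥)
open import Relation.Nullary using (¬_)
open import Relation.Binary.PropositionalEquality using (_≡_)
open import Function.Bundles using (_⇔_)
open import Function.Definitions using (Injective)

record Graph (n : ℕ) : Set₁ where
  field
    Adj     : Fin n → Fin n → Set
    sym     : ∀ {x y} → Adj x y → Adj y x
    irrefl  : ∀ {x} → ¬ Adj x x
open Graph public

data Path {n : ℕ} (G : Graph n) : Fin n → Fin n → Set where
  []   : ∀ {x} → Path G x x
  step : ∀ {x y z} → Adj G x y → Path G y z → Path G x z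

len : ∀ {n} {G : Graph n} {x y} → Path G x y → ℕ
len []         = zero
len (step _ p) = suc (len p)

Shortest : ∀ {n} {G : Graph n} {x y} → Path G x y → Set
Shortest {G = G} {x} {y} p = ∀ (q : Path G x y) → len p ≤ len q

AvoidsInterior : ∀ {n} {G : Graph n} {x y} → Subset n → Path G x y → Set
AvoidsInterior X []                           = ⊤
AvoidsInterior X (step _ [])                  = ⊤
AvoidsInterior X (step {y = y} _ (step e p))  = (y ∉ X) × AvoidsInterior X (step e p)

Connected : ∀ {n} → Graph n → Set
Connected G = ∀ x y → Path G x y

Visible : ∀ {n} (G : Graph n) → Subset n → Fin n → Fin n → Set
Visible G X x y = Σ (Path G x y) λ p → Shortest p × AvoidsInterior X p

IsDMV : ∀ {n} (G : Graph n) → Subset n → Set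
IsDMV G X =
  (∀ x y → x ∈ X → y ∈ X → Visible G X x y) ×
  (∀ x y → x ∉ X → y ∉ X → Visible G X x y)

MuD≡ : ∀ {n} → Graph n → ℕ → Set
MuD≡ {n} G k =
  (Σ (Subset n) λ X → IsDMV G X × ∣ X ∣ ≡ k) ×
  (∀ X → IsDMV G X → ∣ X ∣ ≤ k)

NumDMVOfSize≡ : ∀ {n} → Graph n → ℕ → ℕ → Set
NumDMVOfSize≡ {n} G i r =
  Σ (Fin r → Subset n) λ f →
    Injective _≡_ _≡_ f ×
    (∀ X → (IsDMV G X × ∣ X ∣ ≡ i) ⇔ (∃ λ j → f j ≡ X))

DualVisSpectrum≡ : ∀ {n} → Graph n → (k : ℕ) → (Fin (suc k) → ℕ) → Set
DualVisSpectrum≡ G k r = MuD≡ G k × (∀ (i : Fin (suc k)) → NumDMVOfSize≡ G (toℕ i) (r i))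

module Submission where

-- Take a clique for every prescribed group (r_i groups with i vertices, for 1 ≤ i ≤ k) and add
-- anchor vertices, each carrying a private copy of the Petersen graph attached at one vertex.
-- No Petersen vertex q lies in a dual mutual-visibility set X: two of its three neighbours are on
-- the same side of X, they are at distance two, and by girth five q is their only common
-- neighbour. An anchor adjacent to u alone then forces the whole group of u into X as soon as
-- u ∈ X, and an anchor adjacent exactly to the groups g and h, at distance two from an anchor
-- adjacent to all clique vertices, forbids X to meet both g and h. Conversely ∅ and every group
-- are dual mutual-visibility sets: every pair outside the set is joined by a path avoiding it
-- whose length equals a potential D that grows by at most one along each edge, so the path is
-- shortest. Hence the dual mutual-visibility sets of size i are exactly the groups with i
-- vertices (and ∅ for i = 0).

open import Defs
open import Data.Nat using (ℕ; suc; _<_)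
open import Data.Fin using (Fin; zero; fromℕ)
open import Data.Product using (Σ; _×_)
open import Relation.Binary.PropositionalEquality using (_≡_)

open import Data.Nat using (zero; _+_; _*_; _≤_; z≤n; s≤s; _≡ᵇ_)
import Data.Nat.Properties as ℕ
open import Data.Fin using (suc; toℕ; fromℕ<; _≟_)
open import Data.Fin.Properties using (any?; all?; suc-injective; +↔⊎; *↔×; toℕ<n; toℕ-injective; toℕ-fromℕ)
open import Data.Fin.Subset using (Subset; _∈_; _∉_; ∣_∣; outside; inside)
open import Data.Fin.Subset.Properties using (Empty-unique; ∣⊥∣≡0; nonempty?; ⊆-antisym)
open import Data.Bool using (Bool; true; false; T; _∧_; _∨_)
open import Data.Bool.Properties using (T?; ∨-comm)
open import Data.Bool.ListAction using (any)
open import Data.List using (List; []; _∷_)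
open import Data.Maybe using (Maybe; just; nothing)
open import Data.Vec using (lookup; tabulate; _∷_; _[_]≔_)
open import Data.Vec.Properties using ([]=⇒lookup; lookup⇒[]=; lookup∘update; lookup∘update′; lookup∘tabulate)
open import Data.Product using (∃; ∃₂; _,_; proj₁; proj₂)
open import Data.Product.Function.NonDependent.Propositional using (_×-↔_)
open import Data.Product.Properties.WithK using (,-injectiveʳ)
import Data.Product.Properties as Product
open import Data.Sum using (_⊎_; inj₁; inj₂)
open import Data.Sum.Function.Propositional using (_⊎-↔_)
import Data.Sum.Properties as Sum
open import Data.Unit using (⊤; tt)
open import Data.Empty using (⊥; ⊥-elim)
open import Function using (_∘_; _∋_; _↔_; Inverse; mk↔ₛ′; mk⇔)
open import Function.Definitions using (Injective)
open import Function.Properties.Inverse using (↔-refl; ↔-trans)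
open import Relation.Nullary using (¬_; Dec; yes; no; does; contradiction)
open import Relation.Nullary.Decidable using (_×-dec_; _⊎-dec_; _→-dec_; ¬?; toWitness; dec-true)
open import Relation.Binary.Definitions using (DecidableEquality)
open import Relation.Binary.PropositionalEquality using (_≢_; refl; trans; cong; cong₂; subst; subst₂)
  renaming (sym to ≡-sym)

module _ {n : ℕ} {G : Graph n} where

  infixr 5 _++ₚ_

  _++ₚ_ : ∀ {x y z} → Path G x y → Path G y z → Path G x z
  []       ++ₚ q = q
  step e p ++ₚ q = step e (p ++ₚ q)

  len-++ₚ : ∀ {x y z} (p : Path G x y) (q : Path G y z) → len (p ++ₚ q) ≡ len p + len q
  len-++ₚ []       q = refl
  len-++ₚ (step e p) q = cong suc (len-++ₚ p q)

  avoids-++ₚ : ∀ {X x y z} (p : Path G x y) (q : Path G y z) →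
               AvoidsInterior X p → y ∉ X → AvoidsInterior X q → AvoidsInterior X (p ++ₚ q)
  avoids-++ₚ []                  q            _          _   aq = aq
  avoids-++ₚ (step e [])         []           _          _   _  = tt
  avoids-++ₚ (step e [])         (step e′ q)  _          y∉X aq = y∉X , aq
  avoids-++ₚ (step e (step e′ p)) q           (z∉X , ap) y∉X aq = z∉X , avoids-++ₚ (step e′ p) q ap y∉X aq

  reverseₚ : ∀ {x y} → Path G x y → Path G y x
  reverseₚ []         = []
  reverseₚ (step e p) = reverseₚ p ++ₚ step (sym G e) []

  len-reverseₚ : ∀ {x y} (p : Path G x y) → len (reverseₚ p) ≡ len p
  len-reverseₚ []         = refl
  len-reverseₚ (step e p) = trans (len-++ₚ (reverseₚ p) _) (trans (ℕ.+-comm _ 1) (cong suc (len-reverseₚ p)))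

  avoids-reverseₚ : ∀ {X x y} (p : Path G x y) → AvoidsInterior X p → AvoidsInterior X (reverseₚ p)
  avoids-reverseₚ []                   _          = tt
  avoids-reverseₚ (step e [])          _          = tt
  avoids-reverseₚ (step e (step e′ p)) (z∉X , ap) =
    avoids-++ₚ (reverseₚ (step e′ p)) (step (sym G e) []) (avoids-reverseₚ (step e′ p) ap) z∉X tt

module _ {m n : ℕ} {H : Graph m} {G : Graph n} (f : Fin m → Fin n)
         (f-adj : ∀ {x y} → Adj H x y → Adj G (f x) (f y)) where

  mapₚ : ∀ {x y} → Path H x y → Path G (f x) (f y)
  mapₚ []         = []
  mapₚ (step e p) = step (f-adj e) (mapₚ p)

  len-mapₚ : ∀ {x y} (p : Path H x y) → len (mapₚ p) ≡ len p
  len-mapₚ []         = refl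
  len-mapₚ (step e p) = cong suc (len-mapₚ p)

  avoids-mapₚ : ∀ {X x y} → (∀ z → f z ∉ X) → (p : Path H x y) → AvoidsInterior X (mapₚ p)
  avoids-mapₚ f∉X []                   = tt
  avoids-mapₚ f∉X (step e [])          = tt
  avoids-mapₚ f∉X (step e (step e′ p)) = f∉X _ , avoids-mapₚ f∉X (step e′ p)

module Potential {n : ℕ} (G : Graph n) {d : Fin n → Fin n → ℕ}
                 (d-refl : ∀ x → d x x ≡ 0)
                 (d-lip : ∀ {x x′} z → Adj G x x′ → d x z ≤ suc (d x′ z)) where

  d≤len : ∀ {x y} (p : Path G x y) → d x y ≤ len p
  d≤len {x} []             = ℕ.≤-reflexive (d-refl x)
  d≤len {y = y} (step e p) = ℕ.≤-trans (d-lip y e) (s≤s (d≤len p))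

  visible-by-path : ∀ {X x y} (p : Path G x y) → len p ≡ d x y → AvoidsInterior X p → Visible G X x y
  visible-by-path p len≡d avoids = p , (λ q → subst (_≤ len q) (≡-sym len≡d) (d≤len q)) , avoids

-- The distance truncated at three: decidable and 1-Lipschitz along edges in every graph, and
-- used below only between vertices at distance at most three.
module TruncatedDistance {n : ℕ} (G : Graph n) (adj? : ∀ x y → Dec (Adj G x y)) where

  CommonNeighbour : Fin n → Fin n → Set
  CommonNeighbour x y = ∃ λ c → Adj G x c × Adj G c y

  common? : ∀ x y → Dec (CommonNeighbour x y)
  common? x y = any? λ c → adj? x c ×-dec adj? c y

  opaque
    dist₃ : Fin n → Fin n → ℕ
    dist₃ x y with x ≟ y | adj? x y | common? x y
    ... | yes _ | _     | _     = 0
    ... | no _  | yes _ | _     = 1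
    ... | no _  | no _  | yes _ = 2
    ... | no _  | no _  | no _  = 3

    dist₃-refl : ∀ x → dist₃ x x ≡ 0
    dist₃-refl x with x ≟ x
    ... | yes _   = refl
    ... | no x≢x  = contradiction refl x≢x

    dist₃-adj : ∀ {x y} → Adj G x y → dist₃ x y ≡ 1
    dist₃-adj {x} {y} x~y with x ≟ y | adj? x y
    ... | yes refl | _      = contradiction x~y (irrefl G)
    ... | no _     | yes _  = refl
    ... | no _     | no x≁y = contradiction x~y x≁y

    dist₃-common : ∀ {x y c} → x ≢ y → ¬ Adj G x y → Adj G x c → Adj G c y → dist₃ x y ≡ 2
    dist₃-common {x} {y} x≢y x≁y x~c c~y with x ≟ y | adj? x y | common? x y
    ... | yes x≡y | _      | _     = contradiction x≡y x≢y
    ... | no _    | yes x~y | _    = contradiction x~y x≁y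
    ... | no _    | no _   | yes _ = refl
    ... | no _    | no _   | no ∄c = contradiction (_ , x~c , c~y) ∄c

    dist₃-far : ∀ {x y} → x ≢ y → ¬ Adj G x y → ¬ CommonNeighbour x y → dist₃ x y ≡ 3
    dist₃-far {x} {y} x≢y x≁y ∄c with x ≟ y | adj? x y | common? x y
    ... | yes x≡y | _       | _     = contradiction x≡y x≢y
    ... | no _    | yes x~y | _     = contradiction x~y x≁y
    ... | no _    | no _    | yes c = contradiction c ∄c
    ... | no _    | no _    | no _  = refl

    dist₃≤3 : ∀ x y → dist₃ x y ≤ 3
    dist₃≤3 x y with x ≟ y | adj? x y | common? x y
    ... | yes _ | _     | _     = z≤n
    ... | no _  | yes _ | _     = s≤s z≤n
    ... | no _  | no _  | yes _ = s≤s (s≤s z≤n)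
    ... | no _  | no _  | no _  = ℕ.≤-refl

    dist₃≤2 : ∀ {x y c} → Adj G x c → Adj G c y → dist₃ x y ≤ 2
    dist₃≤2 {x} {y} x~c c~y with x ≟ y | adj? x y | common? x y
    ... | yes _ | _     | _     = z≤n
    ... | no _  | yes _ | _     = s≤s z≤n
    ... | no _  | no _  | yes _ = ℕ.≤-refl
    ... | no _  | no _  | no ∄c = contradiction (_ , x~c , c~y) ∄c

    dist₃-lip : ∀ {x x′} z → Adj G x x′ → dist₃ x z ≤ suc (dist₃ x′ z)
    dist₃-lip {x} {x′} z x~x′ with x′ ≟ z | adj? x′ z | common? x′ z
    ... | yes refl | _       | _     = ℕ.≤-reflexive (dist₃-adj x~x′)
    ... | no _     | yes x′~z | _    = dist₃≤2 x~x′ x′~z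
    ... | no _     | no _    | yes _ = dist₃≤3 x z
    ... | no _     | no _    | no _  = ℕ.m≤n⇒m≤1+n (dist₃≤3 x z)

    dist₃-sym : ∀ x y → dist₃ x y ≡ dist₃ y x
    dist₃-sym x y with x ≟ y | adj? x y | common? x y
    ... | yes refl | _       | _                    = ≡-sym (dist₃-refl x)
    ... | no _     | yes x~y | _                    = ≡-sym (dist₃-adj (sym G x~y))
    ... | no x≢y   | no x≁y  | yes (c , x~c , c~y) =
      ≡-sym (dist₃-common (λ y≡x → x≢y (≡-sym y≡x)) (λ y~x → x≁y (sym G y~x)) (sym G c~y) (sym G x~c))
    ... | no x≢y   | no x≁y  | no ∄c                =
      ≡-sym (dist₃-far (λ y≡x → x≢y (≡-sym y≡x)) (λ y~x → x≁y (sym G y~x))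
                       (λ { (c , y~c , c~x) → ∄c (c , sym G c~x , sym G y~c) }))

    path-of-length-dist₃ : (∀ x y → x ≢ y → ¬ Adj G x y → CommonNeighbour x y) →
                           ∀ x y → Σ (Path G x y) λ p → len p ≡ dist₃ x y
    path-of-length-dist₃ diameter₂ x y with x ≟ y | adj? x y | common? x y
    ... | yes refl | _       | _                    = [] , refl
    ... | no _     | yes x~y | _                    = step x~y [] , refl
    ... | no _     | no _    | yes (c , x~c , c~y) = step x~c (step c~y []) , refl
    ... | no x≢y   | no x≁y  | no ∄c                = contradiction (diameter₂ x y x≢y x≁y) ∄c

module _ {n : ℕ} {X : Subset n} where

  lookup≡false⇒∉ : ∀ {x} → lookup X x ≡ false → x ∉ X
  lookup≡false⇒∉ x∉X x∈X with trans (≡-sym ([]=⇒lookup x∈X)) x∉X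
  ... | ()

  ∉⇒lookup≡false : ∀ {x} → x ∉ X → lookup X x ≡ false
  ∉⇒lookup≡false {x} x∉X with lookup X x in eq
  ... | true  = contradiction (lookup⇒[]= x X eq) x∉X
  ... | false = refl

module _ {n : ℕ} {P : Fin n → Set} (P? : ∀ i → Dec (P i)) where

  ∈tabulate⇒ : ∀ {i} → i ∈ tabulate (does ∘ P?) → P i
  ∈tabulate⇒ {i} i∈ with P? i | trans (≡-sym (lookup∘tabulate (does ∘ P?) i)) ([]=⇒lookup i∈)
  ... | yes Pi | _ = Pi
  ... | no _   | ()

  ∈tabulate⇐ : ∀ {i} → P i → i ∈ tabulate (does ∘ P?)
  ∈tabulate⇐ {i} Pi = lookup⇒[]= i _ (trans (lookup∘tabulate (does ∘ P?) i) (dec-true (P? i) Pi))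

module _ {n : ℕ} {G : Graph n} where

  edge-visible : ∀ {X x y} → x ≢ y → Adj G x y → Visible G X x y
  edge-visible x≢y x~y = step x~y [] , at-least-one , tt
    where
    at-least-one : ∀ q → 1 ≤ len q
    at-least-one []         = contradiction refl x≢y
    at-least-one (step _ _) = s≤s z≤n

module _ {n : ℕ} {G : Graph n} {X : Subset n} (dmv : IsDMV G X) where

  visible-on-same-side : ∀ x y → lookup X x ≡ lookup X y → Visible G X x y
  visible-on-same-side x y same with lookup X x in ex | lookup X y in ey
  ... | true  | true  = proj₁ dmv x y (lookup⇒[]= x X ex) (lookup⇒[]= y X ey)
  ... | false | false = proj₂ dmv x y (lookup≡false⇒∉ ex) (lookup≡false⇒∉ ey)

  -- A shortest path between vertices at distance two runs through a common neighbour.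
  common-neighbours⊆X⇒opposite-sides : ∀ {x y c} → x ≢ y → ¬ Adj G x y → Adj G x c → Adj G c y →
    (∀ c → Adj G x c → Adj G c y → c ∈ X) → lookup X x ≢ lookup X y
  common-neighbours⊆X⇒opposite-sides {x} {y} x≢y x≁y x~c c~y common⊆X same
    with visible-on-same-side x y same
  ... | p , shortest , avoids = through p (shortest (step x~c (step c~y []))) avoids
    where
    through : (p : Path G x y) → len p ≤ 2 → ¬ AvoidsInterior X p
    through []                           _                   _         = x≢y refl
    through (step x~y [])                _                   _         = x≁y x~y
    through (step x~c′ (step c′~y []))   _                   (c′∉X , _) = c′∉X (common⊆X _ x~c′ c′~y)
    through (step _ (step _ (step _ _))) (s≤s (s≤s ()))      _

∣p∣≡1+∣p[x]≔outside∣ : ∀ {n} (p : Subset n) x → lookup p x ≡ true → ∣ p ∣ ≡ suc ∣ p [ x ]≔ outside ∣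
∣p∣≡1+∣p[x]≔outside∣ (inside  ∷ p) zero    _   = refl
∣p∣≡1+∣p[x]≔outside∣ (inside  ∷ p) (suc x) x∈p = cong suc (∣p∣≡1+∣p[x]≔outside∣ p x x∈p)
∣p∣≡1+∣p[x]≔outside∣ (outside ∷ p) (suc x) x∈p = ∣p∣≡1+∣p[x]≔outside∣ p x x∈p

∣p∣≡enumeration : ∀ {n} s (p : Subset n) (e : Fin s → Fin n) → Injective _≡_ _≡_ e →
                  (∀ j → e j ∈ p) → (∀ i → i ∈ p → ∃ λ j → e j ≡ i) → ∣ p ∣ ≡ s
∣p∣≡enumeration {n} zero p e _ _ onto =
  trans (cong ∣_∣ (Empty-unique {p = p} λ { (i , i∈p) → Fin0-empty (onto i i∈p) })) (∣⊥∣≡0 n)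
  where
  Fin0-empty : ∀ {i} → ¬ ∃ λ (j : Fin 0) → e j ≡ i
  Fin0-empty (() , _)
∣p∣≡enumeration (suc s) p e injective into onto =
  trans (∣p∣≡1+∣p[x]≔outside∣ p (e zero) ([]=⇒lookup (into zero)))
        (cong suc (∣p∣≡enumeration s p′ (e ∘ suc) (λ eq → suc-injective (injective eq)) into′ onto′))
  where
  p′ : Subset _
  p′ = p [ e zero ]≔ outside
  e-suc≢e-zero : ∀ j → e (suc j) ≢ e zero
  e-suc≢e-zero j eq with injective eq
  ... | ()
  into′ : ∀ j → e (suc j) ∈ p′
  into′ j = lookup⇒[]= _ p′ (trans (lookup∘update′ (e-suc≢e-zero j) p outside) ([]=⇒lookup (into (suc j))))
  onto′ : ∀ i → i ∈ p′ → ∃ λ j → e (suc j) ≡ i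
  onto′ i i∈p′ with i ≟ e zero
  ... | yes refl with trans (≡-sym (lookup∘update (e zero) p outside)) ([]=⇒lookup i∈p′)
  ...   | ()
  onto′ i i∈p′ | no i≢e0
    with onto i (lookup⇒[]= i p (trans (≡-sym (lookup∘update′ i≢e0 p outside)) ([]=⇒lookup i∈p′)))
  ...   | zero  , e0≡i = contradiction (≡-sym e0≡i) i≢e0
  ...   | suc j , ej≡i = j , ej≡i

two-of-three-agree : ∀ (a b c : Bool) → a ≡ b ⊎ a ≡ c ⊎ b ≡ c
two-of-three-agree true  true  _     = inj₁ refl
two-of-three-agree false false _     = inj₁ refl
two-of-three-agree true  false true  = inj₂ (inj₁ refl)
two-of-three-agree true  false false = inj₂ (inj₂ refl)
two-of-three-agree false true  true  = inj₂ (inj₂ refl)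
two-of-three-agree false true  false = inj₂ (inj₁ refl)

∑ : ∀ {n} → (Fin n → ℕ) → ℕ
∑ {zero}  f = 0
∑ {suc n} f = f zero + ∑ (f ∘ suc)

Σ-Fin↔ : ∀ {n} (f : Fin n → ℕ) → Fin (∑ f) ↔ Σ (Fin n) (Fin ∘ f)
Σ-Fin↔ {zero}  f = mk↔ₛ′ (λ ()) (λ ()) (λ ()) (λ ())
Σ-Fin↔ {suc n} f = ↔-trans +↔⊎ (↔-trans (↔-refl ⊎-↔ Σ-Fin↔ (f ∘ suc)) split)
  where
  split : (Fin (f zero) ⊎ Σ (Fin n) (Fin ∘ f ∘ suc)) ↔ Σ (Fin (suc n)) (Fin ∘ f)
  split = mk↔ₛ′ (λ { (inj₁ j) → zero , j ; (inj₂ (a , j)) → suc a , j })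
                (λ { (zero , j) → inj₁ j ; (suc a , j) → inj₂ (a , j) })
                (λ { (zero , j) → refl ; (suc a , j) → refl })
                (λ { (inj₁ j) → refl ; (inj₂ (a , j)) → refl })

module PetersenGraph where

  edges : List (ℕ × ℕ)
  edges = (0 , 1) ∷ (1 , 2) ∷ (2 , 3) ∷ (3 , 4) ∷ (4 , 0)
        ∷ (0 , 5) ∷ (1 , 6) ∷ (2 , 7) ∷ (3 , 8) ∷ (4 , 9)
        ∷ (5 , 7) ∷ (7 , 9) ∷ (9 , 6) ∷ (6 , 8) ∷ (8 , 5) ∷ []

  adjacent : Fin 10 → Fin 10 → Bool
  adjacent a b = any (λ { (x , y) → ((x ≡ᵇ toℕ a) ∧ (y ≡ᵇ toℕ b)) ∨ ((x ≡ᵇ toℕ b) ∧ (y ≡ᵇ toℕ a)) }) edges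

  adj? : ∀ a b → Dec (T (adjacent a b))
  adj? a b = T? (adjacent a b)

  -- The finite facts below are checked by evaluating decision procedures; they are opaque
  -- so that these evaluations are never unfolded again where the facts are used.
  opaque
    adjacent-sym : ∀ a b → T (adjacent a b) → T (adjacent b a)
    adjacent-sym = toWitness {a? = all? λ a → all? λ b → adj? a b →-dec adj? b a} _

    adjacent-irrefl : ∀ a → ¬ T (adjacent a a)
    adjacent-irrefl = toWitness {a? = all? λ a → ¬? (adj? a a)} _

  Petersen : Graph 10
  Petersen = record
    { Adj    = λ a b → T (adjacent a b)
    ; sym    = λ {a} {b} → adjacent-sym a b
    ; irrefl = λ {a} → adjacent-irrefl a
    }

  open TruncatedDistance Petersen adj? public using (CommonNeighbour; dist₃; dist₃-refl; dist₃-lip)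

  opaque
    diameter-two : ∀ a b → a ≢ b → ¬ Adj Petersen a b → CommonNeighbour a b
    diameter-two = toWitness
      {a? = all? λ a → all? λ b → ¬? (a ≟ b) →-dec (¬? (adj? a b) →-dec any? λ c → adj? a c ×-dec adj? c b)} _

    girth-five : ∀ q x y → Adj Petersen q x → Adj Petersen q y → x ≢ y →
                 ¬ Adj Petersen x y × (∀ c → Adj Petersen x c → Adj Petersen c y → c ≡ q)
    girth-five = toWitness
      {a? = all? λ q → all? λ x → all? λ y → adj? q x →-dec (adj? q y →-dec (¬? (x ≟ y) →-dec
              (¬? (adj? x y) ×-dec all? λ c → adj? x c →-dec (adj? c y →-dec (c ≟ q)))))} _

    three-neighbours : ∀ q → ∃₂ λ x y → ∃ λ z →
      (Adj Petersen q x × Adj Petersen q y × Adj Petersen q z) × (x ≢ y × x ≢ z × y ≢ z)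
    three-neighbours = toWitness
      {a? = all? λ q → any? λ x → any? λ y → any? λ z →
              (adj? q x ×-dec adj? q y ×-dec adj? q z) ×-dec (¬? (x ≟ y) ×-dec ¬? (x ≟ z) ×-dec ¬? (y ≟ z))} _

  open TruncatedDistance Petersen adj? using (path-of-length-dist₃)

  geodesic : ∀ a b → Σ (Path Petersen a b) λ p → len p ≡ dist₃ a b
  geodesic = path-of-length-dist₃ diameter-two

open PetersenGraph using (Petersen)
module P = PetersenGraph

module Construction (m M : ℕ) (group : Fin M → Fin m) (rep : Fin m → Fin M)
                    (group-rep : ∀ g → group (rep g) ≡ g) where

  Anchor : Set
  Anchor = Fin 3 ⊎ (Fin M ⊎ (Fin m × Fin m))

  pattern centre       = inj₁ zero
  pattern relay        = inj₁ (suc zero)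
  pattern apex         = inj₁ (suc (suc zero))
  pattern pendant u    = inj₂ (inj₁ u)
  pattern bridge g h   = inj₂ (inj₂ (g , h))

  _≟ᴬ_ : DecidableEquality Anchor
  _≟ᴬ_ = Sum.≡-dec _≟_ (Sum.≡-dec _≟_ (Product.≡-dec _≟_ _≟_))

  V : Set
  V = (Anchor × Fin 10) ⊎ Fin M

  pattern blob b a = inj₁ (b , a)
  pattern root b   = inj₁ (b , zero)
  pattern main u   = inj₂ u

  N : ℕ
  N = (3 + (M + m * m)) * 10 + M

  vertices : Fin N ↔ V
  vertices = ↔-trans +↔⊎ (↔-trans *↔× (anchors ×-↔ ↔-refl) ⊎-↔ ↔-refl)
    where
    anchors : Fin (3 + (M + m * m)) ↔ Anchor
    anchors = ↔-trans +↔⊎ (↔-refl ⊎-↔ ↔-trans +↔⊎ (↔-refl ⊎-↔ *↔×))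

  open Inverse vertices public using ()
    renaming (to to vertex; from to index; strictlyInverseˡ to vertex-index; strictlyInverseʳ to index-vertex)

  anchor-arc : Anchor → Anchor → Bool
  anchor-arc centre (bridge g h) = does (g ≟ h)
  anchor-arc centre relay        = true
  anchor-arc relay  apex         = true
  anchor-arc relay  (pendant _)  = true
  anchor-arc apex   (pendant _)  = true
  anchor-arc apex   (bridge _ _) = true
  anchor-arc _      _            = false

  AnchorAdj : Anchor → Anchor → Set
  AnchorAdj b c = T (anchor-arc b c ∨ anchor-arc c b)

  anchor-sym : ∀ b c → AnchorAdj b c → AnchorAdj c b
  anchor-sym b c = subst T (∨-comm (anchor-arc b c) (anchor-arc c b))

  anchor-irrefl : ∀ b → ¬ AnchorAdj b b
  anchor-irrefl centre       ()
  anchor-irrefl relay        ()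
  anchor-irrefl apex         ()
  anchor-irrefl (pendant _)  ()
  anchor-irrefl (bridge _ _) ()

  Attached : Fin M → Anchor → Set
  Attached u centre       = ⊤
  Attached u relay        = ⊥
  Attached u apex         = ⊥
  Attached u (pendant u′) = u ≡ u′
  Attached u (bridge g h) = group u ≡ g ⊎ group u ≡ h

  attached? : ∀ u b → Dec (Attached u b)
  attached? u centre       = yes tt
  attached? u relay        = no λ ()
  attached? u apex         = no λ ()
  attached? u (pendant u′) = u ≟ u′
  attached? u (bridge g h) = group u ≟ g ⊎-dec group u ≟ h

  -- The vertices of each group form a clique; every anchor carries a private copy of the Petersen
  -- graph and is joined to the rest of the graph through the root 0 of that copy only.
  infix 4 _~_ _~?_

  _~_ : V → V → Set
  main u   ~ main u′   = group u ≡ group u′ × u ≢ u′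
  main u   ~ blob b a  = a ≡ zero × Attached u b
  blob b a ~ main u    = a ≡ zero × Attached u b
  blob b a ~ blob c a′ = b ≡ c × Adj Petersen a a′ ⊎ a ≡ zero × a′ ≡ zero × AnchorAdj b c

  _~?_ : ∀ v w → Dec (v ~ w)
  main u   ~? main u′   = group u ≟ group u′ ×-dec ¬? (u ≟ u′)
  main u   ~? blob b a  = a ≟ zero ×-dec attached? u b
  blob b a ~? main u    = a ≟ zero ×-dec attached? u b
  blob b a ~? blob c a′ = b ≟ᴬ c ×-dec P.adj? a a′ ⊎-dec a ≟ zero ×-dec a′ ≟ zero ×-dec T? _

  ~-sym : ∀ {v w} → v ~ w → w ~ v
  ~-sym {main _}   {main _}   (same , u≢u′)             = ≡-sym same , λ u′≡u → u≢u′ (≡-sym u′≡u)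
  ~-sym {main _}   {blob _ _} e                         = e
  ~-sym {blob _ _} {main _}   e                         = e
  ~-sym {blob _ a} {blob _ a′} (inj₁ (refl , a~a′))     = inj₁ (refl , sym Petersen {a} {a′} a~a′)
  ~-sym {blob b _} {blob c _} (inj₂ (a≡0 , a′≡0 , b~c)) = inj₂ (a′≡0 , a≡0 , anchor-sym b c b~c)

  ~-irrefl : ∀ {v} → ¬ v ~ v
  ~-irrefl {main _}   (_ , u≢u)         = u≢u refl
  ~-irrefl {blob _ a} (inj₁ (_ , a~a))   = irrefl Petersen {a} a~a
  ~-irrefl {blob b _} (inj₂ (_ , _ , b~b)) = anchor-irrefl b b~b

  G : Graph N
  G = record
    { Adj    = λ i j → vertex i ~ vertex j
    ; sym    = ~-sym
    ; irrefl = ~-irrefl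
    }

  ~⇒Adj : ∀ {v w} → v ~ w → Adj G (index v) (index w)
  ~⇒Adj {v} {w} = subst₂ _~_ (≡-sym (vertex-index v)) (≡-sym (vertex-index w))

  Adj⇒~ : ∀ {v w} → Adj G (index v) (index w) → v ~ w
  Adj⇒~ {v} {w} = subst₂ _~_ (vertex-index v) (vertex-index w)

  index-injective : ∀ {v w} → index v ≡ index w → v ≡ w
  index-injective {v} {w} eq = trans (≡-sym (vertex-index v)) (trans (cong vertex eq) (vertex-index w))

  open TruncatedDistance G (λ i j → vertex i ~? vertex j)
    using (dist₃; dist₃-refl; dist₃-adj; dist₃-common; dist₃-far; dist₃-lip; dist₃-sym)

  δ : V → V → ℕ
  δ v w = dist₃ (index v) (index w)

  δ-adj : ∀ {v w} → v ~ w → δ v w ≡ 1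
  δ-adj {v} {w} e = dist₃-adj (~⇒Adj {v} {w} e)

  δ-lip : ∀ {v v′} y → v ~ v′ → δ v y ≤ suc (δ v′ y)
  δ-lip {v} {v′} y e = dist₃-lip (index y) (~⇒Adj {v} {v′} e)

  δ-common : ∀ {v w} c → v ≢ w → ¬ v ~ w → v ~ c → c ~ w → δ v w ≡ 2
  δ-common {v} {w} c v≢w v≁w v~c c~w =
    dist₃-common {c = index c} (λ eq → v≢w (index-injective eq)) (λ e → v≁w (Adj⇒~ {v} {w} e))
                 (~⇒Adj {v} {c} v~c) (~⇒Adj {c} {w} c~w)

  δ-far : ∀ {v w} → v ≢ w → ¬ v ~ w → (∀ c → v ~ c → c ~ w → ⊥) → δ v w ≡ 3
  δ-far {v} {w} v≢w v≁w ∄c =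
    dist₃-far (λ eq → v≢w (index-injective eq)) (λ e → v≁w (Adj⇒~ {v} {w} e))
      λ { (i , v~i , i~w) → ∄c (vertex i) (subst (_~ vertex i) (vertex-index v) v~i)
                                          (subst (vertex i ~_) (vertex-index w) i~w) }

  -- The distance of G: inside a Petersen copy it is the Petersen distance, otherwise a
  -- geodesic leaves through the root of its copy and enters the other one through its root.
  D : V → V → ℕ
  D (main u)   (main u′)   = δ (main u) (main u′)
  D (main u)   (blob c a′) = δ (main u) (root c) + P.dist₃ zero a′
  D (blob b a) (main u′)   = P.dist₃ a zero + δ (root b) (main u′)
  D (blob b a) (blob c a′) with b ≟ᴬ c
  ... | yes _ = P.dist₃ a a′
  ... | no _  = P.dist₃ a zero + δ (root b) (root c) + P.dist₃ zero a′

  D-refl : ∀ v → D v v ≡ 0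
  D-refl (main u) = dist₃-refl _
  D-refl (blob b a) with b ≟ᴬ b
  ... | yes _   = P.dist₃-refl a
  ... | no b≢b  = contradiction refl b≢b

  D-lip : ∀ {v v′} y → v ~ v′ → D v y ≤ suc (D v′ y)
  D-lip {v@(main _)} {v′@(main _)} (main w)    e = δ-lip {v} {v′} (main w) e
  D-lip {v@(main _)} {v′@(main _)} (blob c _)  e = ℕ.+-monoˡ-≤ _ (δ-lip {v} {v′} (root c) e)
  D-lip {v@(main _)} {v′@(root b)} (main w)    e rewrite P.dist₃-refl zero = δ-lip {v} {v′} (main w) e
  D-lip {v@(main _)} {v′@(root b)} (blob c _)  e with b ≟ᴬ c
  ... | yes refl = ℕ.≤-reflexive (cong (_+ _) (δ-adj {v} {v′} e))
  ... | no _     rewrite P.dist₃-refl zero = ℕ.+-monoˡ-≤ _ (δ-lip {v} {v′} (root c) e)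
  D-lip {v@(root b)} {v′@(main _)} (main w)    e rewrite P.dist₃-refl zero = δ-lip {v} {v′} (main w) e
  D-lip {v@(root b)} {v′@(main _)} (blob c _)  e with b ≟ᴬ c
  ... | yes refl = ℕ.≤-trans (ℕ.m≤n+m _ _) (ℕ.n≤1+n _)
  ... | no _     rewrite P.dist₃-refl zero = ℕ.+-monoˡ-≤ _ (δ-lip {v} {v′} (root c) e)
  D-lip {blob b a} {blob _ a′} (main w)    (inj₁ (refl , a~a′)) = ℕ.+-monoˡ-≤ _ (P.dist₃-lip zero a~a′)
  D-lip {blob b a} {blob _ a′} (blob c a″) (inj₁ (refl , a~a′)) with b ≟ᴬ c
  ... | yes _ = P.dist₃-lip a″ a~a′
  ... | no _  = ℕ.+-monoˡ-≤ _ (ℕ.+-monoˡ-≤ _ (P.dist₃-lip zero a~a′))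
  D-lip {v@(root b)} {v′@(root b′)} (main w)    e@(inj₂ _) rewrite P.dist₃-refl zero = δ-lip {v} {v′} (main w) e
  D-lip {v@(root b)} {v′@(root b′)} (blob c _)  e@(inj₂ (_ , _ , b~b′)) with b ≟ᴬ c | b′ ≟ᴬ c
  ... | yes refl | yes refl = contradiction b~b′ (anchor-irrefl b)
  ... | yes refl | no _     rewrite δ-adj {v′} {v} (~-sym {v} {v′} e) | P.dist₃-refl zero =
    ℕ.≤-trans (ℕ.n≤1+n _) (ℕ.n≤1+n _)
  ... | no _     | yes refl rewrite δ-adj {v} {v′} e | P.dist₃-refl zero = ℕ.≤-refl
  ... | no _     | no _     rewrite P.dist₃-refl zero = ℕ.+-monoˡ-≤ _ (δ-lip {v} {v′} (root c) e)

  Member : Maybe (Fin m) → V → Set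
  Member nothing  _          = ⊥
  Member (just g) (main u)   = group u ≡ g
  Member (just _) (blob _ _) = ⊥

  member? : ∀ mg v → Dec (Member mg v)
  member? nothing  _          = no λ ()
  member? (just g) (main u)   = group u ≟ g
  member? (just _) (blob _ _) = no λ ()

  -- candidate nothing is ∅ and candidate (just g) is the group g; these turn out to be all the
  -- dual mutual-visibility sets.
  candidate : Maybe (Fin m) → Subset N
  candidate mg = tabulate λ i → does (member? mg (vertex i))

  ∈candidate⇒Member : ∀ {mg} v → index v ∈ candidate mg → Member mg v
  ∈candidate⇒Member {mg} v v∈ = subst (Member mg) (vertex-index v) (∈tabulate⇒ (member? mg ∘ vertex) v∈)

  Member⇒∈candidate : ∀ {mg} v → Member mg v → index v ∈ candidate mg
  Member⇒∈candidate {mg} v mv = ∈tabulate⇐ (member? mg ∘ vertex) (subst (Member mg) (≡-sym (vertex-index v)) mv)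

  blob∉candidate : ∀ mg b a → index (blob b a) ∉ candidate mg
  blob∉candidate nothing  b a b∈ = ∈candidate⇒Member {nothing} (blob b a) b∈
  blob∉candidate (just g) b a b∈ = ∈candidate⇒Member {just g} (blob b a) b∈

  record Route (X : Subset N) (v w : V) (L : ℕ) : Set where
    constructor route
    field
      path   : Path G (index v) (index w)
      length : len path ≡ L
      avoids : AvoidsInterior X path

  infixr 5 _▸_

  _▸_ : ∀ {X u v w L₁ L₂} → Route X u v L₁ → (index v ∉ X) × Route X v w L₂ → Route X u w (L₁ + L₂)
  route p lp ap ▸ (v∉X , route q lq aq) =
    route (p ++ₚ q) (trans (len-++ₚ p q) (cong₂ _+_ lp lq)) (avoids-++ₚ p q ap v∉X aq)

  reverse-route : ∀ {X v w} → Route X v w (δ v w) → Route X w v (δ w v)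
  reverse-route {v = v} {w} (route p lp ap) =
    route (reverseₚ p) (trans (len-reverseₚ p) (trans lp (dist₃-sym (index v) (index w)))) (avoids-reverseₚ p ap)

  route₀ : ∀ {X v} → Route X v v (δ v v)
  route₀ {v = v} = route [] (≡-sym (dist₃-refl (index v))) tt

  route₁ : ∀ {X v w} → v ~ w → Route X v w (δ v w)
  route₁ {v = v} {w} e = route (step (~⇒Adj {v} {w} e) []) (≡-sym (δ-adj {v} {w} e)) tt

  route₂ : ∀ {X v w} c → v ≢ w → ¬ v ~ w → v ~ c → c ~ w → index c ∉ X → Route X v w (δ v w)
  route₂ {v = v} {w} c v≢w v≁w v~c c~w c∉X =
    route (step (~⇒Adj {v} {c} v~c) (step (~⇒Adj {c} {w} c~w) []))
          (≡-sym (δ-common c v≢w v≁w v~c c~w)) (c∉X , tt)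

  route₃ : ∀ {X v w} c c′ → v ≢ w → ¬ v ~ w → (∀ c → v ~ c → c ~ w → ⊥) →
           v ~ c → c ~ c′ → c′ ~ w → index c ∉ X → index c′ ∉ X → Route X v w (δ v w)
  route₃ {v = v} {w} c c′ v≢w v≁w ∄c v~c c~c′ c′~w c∉X c′∉X =
    route (step (~⇒Adj {v} {c} v~c) (step (~⇒Adj {c} {c′} c~c′) (step (~⇒Adj {c′} {w} c′~w) [])))
          (≡-sym (δ-far v≢w v≁w ∄c)) (c∉X , c′∉X , tt)

  via-root : ∀ mg {b c} d → b ≢ c → ¬ AnchorAdj b c → AnchorAdj b d → AnchorAdj d c →
             Route (candidate mg) (root b) (root c) (δ (root b) (root c))
  via-root mg {b} {c} d b≢c b≁c b~d d~c =
    route₂ (root d) (λ { refl → b≢c refl }) (λ { (inj₁ (b≡c , _)) → b≢c b≡c ; (inj₂ (_ , _ , b~c)) → b≁c b~c })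
           (inj₂ (refl , refl , b~d)) (inj₂ (refl , refl , d~c)) (blob∉candidate mg d zero)

  ¬Member-by-group : ∀ mg {u u′} → group u ≡ group u′ → ¬ Member mg (main u) → ¬ Member mg (main u′)
  ¬Member-by-group (just g) same ¬mu mu′ = ¬mu (trans same mu′)

  main≢root : ∀ {u b} → (V ∋ main u) ≢ root b
  main≢root ()

  pendant-common-neighbour : ∀ {u u′} c → main u′ ~ c → c ~ root (pendant u) → c ≡ main u
  pendant-common-neighbour (main _)              _           (_ , refl)          = refl
  pendant-common-neighbour (blob centre _)       (refl , _)  (inj₁ (() , _))
  pendant-common-neighbour (blob centre _)       (refl , _)  (inj₂ (_ , _ , ()))
  pendant-common-neighbour (blob relay _)        (refl , ()) _
  pendant-common-neighbour (blob apex _)         (refl , ()) _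
  pendant-common-neighbour (blob (pendant _) _)  (refl , _)  (inj₁ (refl , ()))
  pendant-common-neighbour (blob (pendant _) _)  (refl , _)  (inj₂ (_ , _ , ()))
  pendant-common-neighbour (blob (bridge _ _) _) (refl , _)  (inj₁ (() , _))
  pendant-common-neighbour (blob (bridge _ _) _) (refl , _)  (inj₂ (_ , _ , ()))

  no-common-main-pendant : ∀ {u u′} → group u ≢ group u′ → ∀ c → main u ~ c → c ~ root (pendant u′) → ⊥
  no-common-main-pendant diff c u~c c~w with pendant-common-neighbour c u~c c~w
  ... | refl = diff (proj₁ u~c)

  centre~bridge⇒loop : ∀ {g h} → AnchorAdj centre (bridge g h) → g ≡ h
  centre~bridge⇒loop {g} {h} adj with g ≟ h
  ... | yes g≡h = g≡h

  bridge≁centre : ∀ {g h} → g ≢ h → ¬ root (bridge g h) ~ root centre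
  bridge≁centre g≢h (inj₁ (() , _))
  bridge≁centre {g} {h} g≢h (inj₂ (_ , _ , adj)) = g≢h (centre~bridge⇒loop (anchor-sym (bridge g h) centre adj))

  centre~loop : ∀ g → AnchorAdj centre (bridge g g)
  centre~loop g = subst (λ x → T (x ∨ false)) (≡-sym (dec-true (g ≟ g) refl)) tt

  no-common-main-bridge : ∀ {u g h} → ¬ Attached u (bridge g h) → g ≢ h →
                          ∀ c → main u ~ c → c ~ root (bridge g h) → ⊥
  no-common-main-bridge ¬att _   (main _)              (same , _) (_ , att)           =
    ¬att (subst (λ x → x ≡ _ ⊎ x ≡ _) (≡-sym same) att)
  no-common-main-bridge _    g≢h (blob centre _)       (refl , _) (inj₂ (_ , _ , adj)) = g≢h (centre~bridge⇒loop adj)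
  no-common-main-bridge _    _   (blob centre _)       (refl , _) (inj₁ (() , _))
  no-common-main-bridge _    _   (blob relay _)        (refl , ()) _
  no-common-main-bridge _    _   (blob apex _)         (refl , ()) _
  no-common-main-bridge _    _   (blob (pendant _) _)  (refl , _) (inj₁ (() , _))
  no-common-main-bridge _    _   (blob (pendant _) _)  (refl , _) (inj₂ (_ , _ , ()))
  no-common-main-bridge _    _   (blob (bridge _ _) _) (refl , _) (inj₁ (refl , ()))
  no-common-main-bridge _    _   (blob (bridge _ _) _) (refl , _) (inj₂ (_ , _ , ()))

  route-main-main : ∀ mg u u′ → Route (candidate mg) (main u) (main u′) (δ (main u) (main u′))
  route-main-main mg u u′ with u ≟ u′ | group u ≟ group u′
  ... | yes refl | _        = route₀
  ... | no u≢u′  | yes same = route₁ (same , u≢u′)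
  ... | no u≢u′  | no diff  =
    route₂ (root centre) (λ { refl → u≢u′ refl }) (λ (same , _) → diff same) (refl , tt) (refl , tt)
           (blob∉candidate mg centre zero)

  route-main-pendant : ∀ mg u u′ → ¬ Member mg (main u) →
                       Route (candidate mg) (main u) (root (pendant u′)) (δ (main u) (root (pendant u′)))
  route-main-pendant mg u u′ ¬mu with u ≟ u′ | group u ≟ group u′
  ... | yes refl | _        = route₁ (refl , refl)
  ... | no u≢u′  | yes same =
    route₂ (main u′) main≢root (λ (_ , u≡u′) → u≢u′ u≡u′) (same , u≢u′) (refl , refl)
           (λ u′∈ → ¬Member-by-group mg same ¬mu (∈candidate⇒Member (main u′) u′∈))
  ... | no u≢u′  | no diff  =
    route₃ (root (pendant u)) (root apex) main≢root (λ (_ , u≡u′) → u≢u′ u≡u′)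
           (no-common-main-pendant diff) (refl , refl) (inj₂ (refl , refl , tt)) (inj₂ (refl , refl , tt))
           (blob∉candidate mg (pendant u) zero) (blob∉candidate mg apex zero)

  route-main-bridge : ∀ mg u g h →
                      Route (candidate mg) (main u) (root (bridge g h)) (δ (main u) (root (bridge g h)))
  route-main-bridge mg u g h with attached? u (bridge g h) | g ≟ h
  ... | yes att | _        = route₁ (refl , att)
  ... | no ¬att | yes refl =
    route₂ (root centre) main≢root (λ (_ , att) → ¬att att) (refl , tt)
           (inj₂ (refl , refl , centre~loop g))
           (blob∉candidate mg centre zero)
  ... | no ¬att | no g≢h   =
    route₃ (root (pendant u)) (root apex) main≢root (λ (_ , att) → ¬att att)
           (no-common-main-bridge ¬att g≢h) (refl , refl) (inj₂ (refl , refl , tt)) (inj₂ (refl , refl , tt))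
           (blob∉candidate mg (pendant u) zero) (blob∉candidate mg apex zero)

  route-main-root : ∀ mg u b → ¬ Member mg (main u) → Route (candidate mg) (main u) (root b) (δ (main u) (root b))
  route-main-root mg u centre       _   = route₁ (refl , tt)
  route-main-root mg u relay        _   =
    route₂ (root (pendant u)) main≢root (λ ()) (refl , refl) (inj₂ (refl , refl , tt))
           (blob∉candidate mg (pendant u) zero)
  route-main-root mg u apex         _   =
    route₂ (root (pendant u)) main≢root (λ ()) (refl , refl) (inj₂ (refl , refl , tt))
           (blob∉candidate mg (pendant u) zero)
  route-main-root mg u (pendant u′) ¬mu = route-main-pendant mg u u′ ¬mu
  route-main-root mg u (bridge g h) _   = route-main-bridge mg u g h

  representative-outside : ∀ mg {g h} → g ≢ h → ∃ λ u → Attached u (bridge g h) × ¬ Member mg (main u)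
  representative-outside nothing  {g}     _   = rep g , inj₁ (group-rep g) , λ ()
  representative-outside (just k) {g} {h} g≢h with g ≟ k
  ... | yes refl = rep h , inj₂ (group-rep h) , λ gh≡g → g≢h (≡-sym (trans (≡-sym (group-rep h)) gh≡g))
  ... | no g≢k   = rep g , inj₁ (group-rep g) , λ gg≡k → g≢k (trans (≡-sym (group-rep g)) gg≡k)

  route-bridge-centre : ∀ mg g h →
    Route (candidate mg) (root (bridge g h)) (root centre) (δ (root (bridge g h)) (root centre))
  route-bridge-centre mg g h with g ≟ h
  ... | yes refl = route₁ (inj₂ (refl , refl , anchor-sym centre (bridge g g) (centre~loop g)))
  ... | no g≢h with representative-outside mg g≢h
  ...   | u , att , ¬mu =
    route₂ (main u) (λ ()) (bridge≁centre g≢h)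
           (refl , att) (refl , tt) (λ u∈ → ¬mu (∈candidate⇒Member {mg} (main u) u∈))

  route-distinct-roots : ∀ mg b c → b ≢ c → Route (candidate mg) (root b) (root c) (δ (root b) (root c))
  route-distinct-roots mg centre       centre       b≢c = contradiction refl b≢c
  route-distinct-roots mg centre       relay        _   = route₁ (inj₂ (refl , refl , tt))
  route-distinct-roots mg centre       apex         _   = via-root mg relay (λ ()) (λ ()) tt tt
  route-distinct-roots mg centre       (pendant _)  _   = via-root mg relay (λ ()) (λ ()) tt tt
  route-distinct-roots mg centre       (bridge g h) _   = reverse-route (route-bridge-centre mg g h)
  route-distinct-roots mg relay        centre       _   = route₁ (inj₂ (refl , refl , tt))
  route-distinct-roots mg relay        relay        b≢c = contradiction refl b≢c
  route-distinct-roots mg relay        apex         _   = route₁ (inj₂ (refl , refl , tt))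
  route-distinct-roots mg relay        (pendant _)  _   = route₁ (inj₂ (refl , refl , tt))
  route-distinct-roots mg relay        (bridge _ _) _   = via-root mg apex (λ ()) (λ ()) tt tt
  route-distinct-roots mg apex         centre       _   = via-root mg relay (λ ()) (λ ()) tt tt
  route-distinct-roots mg apex         relay        _   = route₁ (inj₂ (refl , refl , tt))
  route-distinct-roots mg apex         apex         b≢c = contradiction refl b≢c
  route-distinct-roots mg apex         (pendant _)  _   = route₁ (inj₂ (refl , refl , tt))
  route-distinct-roots mg apex         (bridge _ _) _   = route₁ (inj₂ (refl , refl , tt))
  route-distinct-roots mg (pendant _)  centre       _   = via-root mg relay (λ ()) (λ ()) tt tt
  route-distinct-roots mg (pendant _)  relay        _   = route₁ (inj₂ (refl , refl , tt))
  route-distinct-roots mg (pendant _)  apex         _   = route₁ (inj₂ (refl , refl , tt))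
  route-distinct-roots mg (pendant _)  (pendant _)  b≢c = via-root mg apex b≢c (λ ()) tt tt
  route-distinct-roots mg (pendant _)  (bridge _ _) _   = via-root mg apex (λ ()) (λ ()) tt tt
  route-distinct-roots mg (bridge g h) centre       _   = route-bridge-centre mg g h
  route-distinct-roots mg (bridge _ _) relay        _   = via-root mg apex (λ ()) (λ ()) tt tt
  route-distinct-roots mg (bridge _ _) apex         _   = route₁ (inj₂ (refl , refl , tt))
  route-distinct-roots mg (bridge _ _) (pendant _)  _   = via-root mg apex (λ ()) (λ ()) tt tt
  route-distinct-roots mg (bridge _ _) (bridge _ _) b≢c = via-root mg apex b≢c (λ ()) tt tt

  route-root-root : ∀ mg b c → Route (candidate mg) (root b) (root c) (δ (root b) (root c))
  route-root-root mg b c with b ≟ᴬ c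
  ... | yes refl = route₀
  ... | no b≢c   = route-distinct-roots mg b c b≢c

  petersen-route : ∀ mg b a a′ → Route (candidate mg) (blob b a) (blob b a′) (P.dist₃ a a′)
  petersen-route mg b a a′ with P.geodesic a a′
  ... | p , lp = route (mapₚ embed embed-adj p) (trans (len-mapₚ embed embed-adj p) lp)
                       (avoids-mapₚ embed embed-adj (blob∉candidate mg b) p)
    where
    embed : Fin 10 → Fin N
    embed x = index (blob b x)
    embed-adj : ∀ {x y} → Adj Petersen x y → Adj G (embed x) (embed y)
    embed-adj {x} {y} e = ~⇒Adj {blob b x} {blob b y} (inj₁ (refl , e))

  full-route : ∀ mg v w → ¬ Member mg v → ¬ Member mg w → Route (candidate mg) v w (D v w)
  full-route mg (main u)   (main u′)   _   _    = route-main-main mg u u′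
  full-route mg (main u)   (blob c a′) ¬mu _    =
    route-main-root mg u c ¬mu ▸ (blob∉candidate mg c zero , petersen-route mg c zero a′)
  full-route mg (blob b a) (main u′)   _   ¬mu′ =
    petersen-route mg b a zero ▸ (blob∉candidate mg b zero , reverse-route (route-main-root mg u′ b ¬mu′))
  full-route mg (blob b a) (blob c a′) _   _    with b ≟ᴬ c
  ... | yes refl = petersen-route mg b a a′
  ... | no _     = (petersen-route mg b a zero ▸ (blob∉candidate mg b zero , route-root-root mg b c))
                   ▸ (blob∉candidate mg c zero , petersen-route mg c zero a′)

  open Potential G {d = λ i j → D (vertex i) (vertex j)} (λ i → D-refl (vertex i))
                   (λ {i} {i′} z e → D-lip {vertex i} {vertex i′} (vertex z) e)

  vertex-injective : ∀ {i j} → vertex i ≡ vertex j → i ≡ j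
  vertex-injective {i} {j} eq = trans (≡-sym (index-vertex i)) (trans (cong index eq) (index-vertex j))

  route⇒path : ∀ {X i j L} → Route X (vertex i) (vertex j) L → Path G i j
  route⇒path {i = i} {j} r = subst₂ (Path G) (index-vertex i) (index-vertex j) (Route.path r)

  route⇒visible : ∀ {X i j} → Route X (vertex i) (vertex j) (D (vertex i) (vertex j)) → Visible G X i j
  route⇒visible {X} {i} {j} (route p lp ap) = move (index-vertex i) (index-vertex j) p lp ap
    where
    move : ∀ {x y} → x ≡ i → y ≡ j → (p : Path G x y) →
           len p ≡ D (vertex i) (vertex j) → AvoidsInterior X p → Visible G X i j
    move refl refl = visible-by-path

  connected : Connected G
  connected i j = route⇒path (full-route nothing (vertex i) (vertex j) (λ ()) (λ ()))

  members-adjacent : ∀ mg v w → Member mg v → Member mg w → v ≢ w → v ~ w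
  members-adjacent (just g) (main u) (main u′) gu≡g gu′≡g v≢w = trans gu≡g (≡-sym gu′≡g) , λ { refl → v≢w refl }

  candidate-dmv : ∀ mg → IsDMV G (candidate mg)
  candidate-dmv mg = among-members , among-non-members
    where
    ∈⇒Member : ∀ {i} → i ∈ candidate mg → Member mg (vertex i)
    ∈⇒Member = ∈tabulate⇒ (member? mg ∘ vertex)
    Member⇒∈ : ∀ {i} → Member mg (vertex i) → i ∈ candidate mg
    Member⇒∈ = ∈tabulate⇐ (member? mg ∘ vertex)
    among-members : ∀ i j → i ∈ candidate mg → j ∈ candidate mg → Visible G (candidate mg) i j
    among-members i j i∈ j∈ with i ≟ j
    ... | yes refl = [] , (λ _ → z≤n) , tt
    ... | no i≢j   = edge-visible i≢j
                       (members-adjacent mg (vertex i) (vertex j) (∈⇒Member i∈) (∈⇒Member j∈)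
                                         (λ eq → i≢j (vertex-injective eq)))
    among-non-members : ∀ i j → i ∉ candidate mg → j ∉ candidate mg → Visible G (candidate mg) i j
    among-non-members i j i∉ j∉ =
      route⇒visible (full-route mg (vertex i) (vertex j) (λ mi → i∉ (Member⇒∈ mi)) (λ mj → j∉ (Member⇒∈ mj)))

  copy-common-neighbour : ∀ {b x y q} → x ≢ y → (∀ c → Adj Petersen x c → Adj Petersen c y → c ≡ q) →
                          ∀ c → blob b x ~ c → c ~ blob b y → c ≡ blob b q
  copy-common-neighbour x≢y _ (main _)   (refl , _)            (refl , _)            = contradiction refl x≢y
  copy-common-neighbour _   u (blob _ a) (inj₁ (refl , x~a))   (inj₁ (refl , a~y))   = cong (blob _) (u a x~a a~y)
  copy-common-neighbour _   _ (blob b _) (inj₁ (refl , _))     (inj₂ (_ , _ , b~b))  = contradiction b~b (anchor-irrefl b)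
  copy-common-neighbour _   _ (blob b _) (inj₂ (_ , _ , b~b))  (inj₁ (refl , _))     = contradiction b~b (anchor-irrefl b)
  copy-common-neighbour x≢y _ (blob _ _) (inj₂ (refl , _ , _)) (inj₂ (_ , refl , _)) = contradiction refl x≢y

  bridge-centre-common-neighbour : ∀ {g h} c → root (bridge g h) ~ c → c ~ root centre →
                                   ∃ λ u → c ≡ main u × Attached u (bridge g h)
  bridge-centre-common-neighbour (main u)         (refl , att)          _                    = u , refl , att
  bridge-centre-common-neighbour (blob _ _)       (inj₁ (refl , 0~a))   (inj₂ (refl , _ , _)) =
    contradiction 0~a (irrefl Petersen {zero})
  bridge-centre-common-neighbour (blob _ _)       (inj₁ (refl , _))     (inj₁ (() , _))
  bridge-centre-common-neighbour (blob centre _)  (inj₂ (_ , refl , _)) (inj₁ (refl , ()))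
  bridge-centre-common-neighbour (blob centre _)  (inj₂ (_ , refl , _)) (inj₂ (_ , _ , ()))
  bridge-centre-common-neighbour (blob relay _)   (inj₂ (_ , _ , ()))   _
  bridge-centre-common-neighbour (blob apex _)    (inj₂ (_ , refl , _)) (inj₁ (() , _))
  bridge-centre-common-neighbour (blob apex _)    (inj₂ (_ , refl , _)) (inj₂ (_ , _ , ()))
  bridge-centre-common-neighbour (blob (pendant _) _)  (inj₂ (_ , _ , ())) _
  bridge-centre-common-neighbour (blob (bridge _ _) _) (inj₂ (_ , _ , ())) _

  module _ {X : Subset N} (dmv : IsDMV G X) where

    opposite-sides : ∀ v w c → v ≢ w → ¬ v ~ w → v ~ c → c ~ w →
                     (∀ c → v ~ c → c ~ w → index c ∈ X) → lookup X (index v) ≢ lookup X (index w)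
    opposite-sides v w c v≢w v≁w v~c c~w common⊆X =
      common-neighbours⊆X⇒opposite-sides dmv {index v} {index w} {index c}
        (λ eq → v≢w (index-injective eq)) (λ e → v≁w (Adj⇒~ {v} {w} e)) (~⇒Adj {v} {c} v~c) (~⇒Adj {c} {w} c~w)
        λ i v~i i~w → subst (_∈ X) (index-vertex i)
          (common⊆X (vertex i) (subst (_~ vertex i) (vertex-index v) v~i)
                               (subst (vertex i ~_) (vertex-index w) i~w))

    neighbours-on-opposite-sides : ∀ b {q x y} → index (blob b q) ∈ X → Adj Petersen q x → Adj Petersen q y →
                                   x ≢ y → lookup X (index (blob b x)) ≢ lookup X (index (blob b y))
    neighbours-on-opposite-sides b {q} {x} {y} q∈X q~x q~y x≢y with P.girth-five q x y q~x q~y x≢y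
    ... | x≁y , unique =
      opposite-sides (blob b x) (blob b y) (blob b q) (λ { refl → x≢y refl })
        (λ { (inj₁ (_ , x~y)) → x≁y x~y ; (inj₂ (refl , refl , _)) → x≢y refl })
        (inj₁ (refl , sym Petersen {q} {x} q~x)) (inj₁ (refl , q~y))
        λ c x~c c~y → subst (λ c → index c ∈ X) (≡-sym (copy-common-neighbour x≢y unique c x~c c~y)) q∈X

    blob∉X : ∀ b q → index (blob b q) ∉ X
    blob∉X b q q∈X with P.three-neighbours q
    ... | x , y , z , (q~x , q~y , q~z) , (x≢y , x≢z , y≢z)
      with two-of-three-agree (lookup X (index (blob b x))) (lookup X (index (blob b y)))
                              (lookup X (index (blob b z)))
    ... | inj₁ same        = neighbours-on-opposite-sides b q∈X q~x q~y x≢y same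
    ... | inj₂ (inj₁ same) = neighbours-on-opposite-sides b q∈X q~x q~z x≢z same
    ... | inj₂ (inj₂ same) = neighbours-on-opposite-sides b q∈X q~y q~z y≢z same

    group-closed : ∀ {u u′} → group u ≡ group u′ → index (main u) ∈ X → index (main u′) ∈ X
    group-closed {u} {u′} same u∈X with u′ ≟ u | lookup X (index (main u′)) in eq
    ... | yes refl | _     = u∈X
    ... | no _     | true  = lookup⇒[]= _ X eq
    ... | no u′≢u  | false =
      contradiction (trans eq (≡-sym (∉⇒lookup≡false (blob∉X (pendant u) zero))))
        (opposite-sides (main u′) (root (pendant u)) (main u) main≢root (λ (_ , u′≡u) → u′≢u u′≡u)
          (≡-sym same , u′≢u) (refl , refl)
          λ c u′~c c~w → subst (λ c → index c ∈ X) (≡-sym (pendant-common-neighbour c u′~c c~w)) u∈X)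

    same-group : ∀ {u u′} → index (main u) ∈ X → index (main u′) ∈ X → group u ≡ group u′
    same-group {u} {u′} u∈X u′∈X with group u ≟ group u′
    ... | yes same = same
    ... | no diff  =
      contradiction (trans (∉⇒lookup≡false (blob∉X (bridge (group u) (group u′)) zero))
                           (≡-sym (∉⇒lookup≡false (blob∉X centre zero))))
        (opposite-sides (root (bridge (group u) (group u′))) (root centre) (main u) (λ ())
          (bridge≁centre diff)
          (refl , inj₁ refl) (refl , tt) common⊆X)
      where
      common⊆X : ∀ c → root (bridge (group u) (group u′)) ~ c → c ~ root centre → index c ∈ X
      common⊆X c e₁ e₂ with bridge-centre-common-neighbour c e₁ e₂
      ... | _ , refl , inj₁ gv≡gu  = group-closed (≡-sym gv≡gu) u∈X
      ... | _ , refl , inj₂ gv≡gu′ = group-closed (≡-sym gv≡gu′) u′∈X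

    dmv-classification : ∃ λ mg → X ≡ candidate mg
    dmv-classification with nonempty? X
    ... | no ∅ = nothing , ⊆-antisym (λ {i} i∈X → contradiction (i , i∈X) ∅)
                                      (λ i∈ → ⊥-elim (∈tabulate⇒ (member? nothing ∘ vertex) i∈))
    ... | yes (i , i∈X) with vertex i in eq
    ...   | blob b a =
      contradiction (subst (_∈ X) (trans (≡-sym (index-vertex i)) (cong index eq)) i∈X) (blob∉X b a)
    ...   | main u   = just (group u) , ⊆-antisym X⊆ ⊆X
      where
      u∈X : index (main u) ∈ X
      u∈X = subst (_∈ X) (trans (≡-sym (index-vertex i)) (cong index eq)) i∈X
      in-group : ∀ v → index v ∈ X → Member (just (group u)) v
      in-group (main u′)  u′∈X = same-group u′∈X u∈X
      in-group (blob b a) b∈X  = blob∉X b a b∈X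
      X⊆ : ∀ {j} → j ∈ X → j ∈ candidate (just (group u))
      X⊆ {j} j∈X = ∈tabulate⇐ (member? (just (group u)) ∘ vertex)
                     (in-group (vertex j) (subst (_∈ X) (≡-sym (index-vertex j)) j∈X))
      members∈X : ∀ v → Member (just (group u)) v → index v ∈ X
      members∈X (main u′) gu′≡gu = group-closed (≡-sym gu′≡gu) u∈X
      ⊆X : ∀ {j} → j ∈ candidate (just (group u)) → j ∈ X
      ⊆X {j} j∈ =
        subst (_∈ X) (index-vertex j) (members∈X (vertex j) (∈tabulate⇒ (member? (just (group u)) ∘ vertex) j∈))

  ∣candidate-nothing∣ : ∣ candidate nothing ∣ ≡ 0
  ∣candidate-nothing∣ = ∣p∣≡enumeration 0 (candidate nothing) (λ ()) (λ { {()} }) (λ ())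
                          (λ i i∈ → ⊥-elim (∈tabulate⇒ (member? nothing ∘ vertex) i∈))

  ∣candidate-just∣ : ∀ {s} g (e : Fin s → Fin M) → Injective _≡_ _≡_ e → (∀ j → group (e j) ≡ g) →
                     (∀ u → group u ≡ g → ∃ λ j → e j ≡ u) → ∣ candidate (just g) ∣ ≡ s
  ∣candidate-just∣ {s} g e e-injective into onto =
    ∣p∣≡enumeration s (candidate (just g)) (index ∘ main ∘ e)
      (λ eq → e-injective (Sum.inj₂-injective (index-injective eq)))
      (λ j → Member⇒∈candidate {just g} (main (e j)) (into j)) onto′
    where
    preimage : ∀ {i} v → index v ≡ i → Member (just g) v → ∃ λ j → index (main (e j)) ≡ i
    preimage (main u) eq gu≡g with onto u gu≡g
    ... | j , refl = j , eq
    onto′ : ∀ i → i ∈ candidate (just g) → ∃ λ j → index (main (e j)) ≡ i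
    onto′ i i∈ = preimage (vertex i) (index-vertex i) (∈tabulate⇒ (member? (just g) ∘ vertex) i∈)

  candidate-injective : ∀ {g g′} → candidate (just g) ≡ candidate (just g′) → g ≡ g′
  candidate-injective {g} {g′} eq = trans (≡-sym (group-rep g))
    (∈candidate⇒Member {just g′} (main (rep g))
      (subst (index (main (rep g)) ∈_) eq (Member⇒∈candidate {just g} (main (rep g)) (group-rep g))))

-- A group of size class i : Fin k has i + 1 members, and there are r (suc i) groups of class i.
module Spectrum (k : ℕ) (r : Fin (suc k) → ℕ) where

  m : ℕ
  m = ∑ (r ∘ suc)

  open Inverse (Σ-Fin↔ (r ∘ suc)) public using ()
    renaming ( to to class; from to group-of
             ; strictlyInverseˡ to class-group-of; strictlyInverseʳ to group-of-class)

  size : Fin m → ℕ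
  size g = suc (toℕ (proj₁ (class g)))

  M : ℕ
  M = ∑ size

  open Inverse (Σ-Fin↔ size) using ()
    renaming ( to to position; from to member
             ; strictlyInverseˡ to position-member; strictlyInverseʳ to member-position)

  group : Fin M → Fin m
  group = proj₁ ∘ position

  rep : Fin m → Fin M
  rep g = member (g , zero)

  group-rep : ∀ g → group (rep g) ≡ g
  group-rep g = cong proj₁ (position-member (g , zero))

  open Construction m M group rep group-rep public

  ∣group∣ : ∀ g → ∣ candidate (just g) ∣ ≡ size g
  ∣group∣ g = ∣candidate-just∣ g (λ j → member (g , j))
    (λ eq → ,-injectiveʳ (trans (≡-sym (position-member _)) (trans (cong position eq) (position-member _))))
    (λ j → cong proj₁ (position-member (g , j)))
    (λ { u refl → proj₂ (position u) , member-position u })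

  class-size : ∀ {g i} → size g ≡ suc (toℕ i) → proj₁ (class g) ≡ i
  class-size eq = toℕ-injective (ℕ.suc-injective eq)

  dmv-bounded : ∀ X → IsDMV G X → ∣ X ∣ ≤ k
  dmv-bounded X dmv = bounded (dmv-classification dmv)
    where
    bounded : (∃ λ mg → X ≡ candidate mg) → ∣ X ∣ ≤ k
    bounded (nothing , refl) = subst (_≤ k) (≡-sym ∣candidate-nothing∣) z≤n
    bounded (just g  , refl) = subst (_≤ k) (≡-sym (∣group∣ g)) (toℕ<n (proj₁ (class g)))

  group-of-class-size : ∀ i {X} → (∃ λ mg → X ≡ candidate mg) → ∣ X ∣ ≡ suc (toℕ i) →
                        ∃ λ j → candidate (just (group-of (i , j))) ≡ X
  group-of-class-size i (nothing , refl) ∣X∣≡ = contradiction (trans (≡-sym ∣candidate-nothing∣) ∣X∣≡) λ ()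
  group-of-class-size i (just g  , refl) ∣X∣≡ =
    subst (λ i → ∃ λ j → candidate (just (group-of (i , j))) ≡ candidate (just g))
          (class-size (trans (≡-sym (∣group∣ g)) ∣X∣≡))
          (proj₂ (class g) , cong (candidate ∘ just) (group-of-class g))

  spectrum : r zero ≡ 1 → ∀ i → NumDMVOfSize≡ G (toℕ i) (r i)
  spectrum r0 zero = (λ _ → candidate nothing) , (λ {j} {j′} _ → Fin-unique r0 j j′) , λ X → mk⇔ (to X) from
    where
    Fin-unique : ∀ {n} → n ≡ 1 → (j j′ : Fin n) → j ≡ j′
    Fin-unique refl zero zero = refl
    to : ∀ X → IsDMV G X × ∣ X ∣ ≡ 0 → ∃ λ j → candidate nothing ≡ X
    to X (dmv , ∣X∣≡0) = by-class (dmv-classification dmv) ∣X∣≡0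
      where
      by-class : (∃ λ mg → X ≡ candidate mg) → ∣ X ∣ ≡ 0 → ∃ λ j → candidate nothing ≡ X
      by-class (nothing , refl) _     = subst Fin (≡-sym r0) zero , refl
      by-class (just g  , refl) ∣X∣≡0 = contradiction (trans (≡-sym (∣group∣ g)) ∣X∣≡0) λ ()
    from : ∀ {X} → (∃ λ j → candidate nothing ≡ X) → IsDMV G X × ∣ X ∣ ≡ 0
    from (_ , refl) = candidate-dmv nothing , ∣candidate-nothing∣
  spectrum r0 (suc i) = (λ j → candidate (just (group-of (i , j)))) , injective , λ X → mk⇔ (to X) from
    where
    injective : Injective _≡_ _≡_ (λ j → candidate (just (group-of (i , j))))
    injective eq =
      ,-injectiveʳ (trans (≡-sym (class-group-of _)) (trans (cong class (candidate-injective eq)) (class-group-of _)))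
    to : ∀ X → IsDMV G X × ∣ X ∣ ≡ suc (toℕ i) → ∃ λ j → candidate (just (group-of (i , j))) ≡ X
    to X (dmv , ∣X∣≡) = group-of-class-size i (dmv-classification dmv) ∣X∣≡
    from : ∀ {X} → (∃ λ j → candidate (just (group-of (i , j))) ≡ X) → IsDMV G X × ∣ X ∣ ≡ suc (toℕ i)
    from (j , refl) = candidate-dmv (just (group-of (i , j))) ,
                      trans (∣group∣ (group-of (i , j))) (cong (suc ∘ toℕ ∘ proj₁) (class-group-of (i , j)))

largest-dmv : ∀ k r → 0 < r (fromℕ k) → let open Spectrum k r in Σ (Subset N) λ X → IsDMV G X × ∣ X ∣ ≡ k
largest-dmv zero    r _   = candidate nothing , candidate-dmv nothing , ∣candidate-nothing∣
  where open Spectrum zero r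
largest-dmv (suc k) r r>0 =
  candidate (just g) , candidate-dmv (just g) ,
  trans (∣group∣ g) (cong suc (trans (cong (toℕ ∘ proj₁) (class-group-of (fromℕ k , fromℕ< r>0))) (toℕ-fromℕ k)))
  where
  open Spectrum (suc k) r
  g : Fin m
  g = group-of (fromℕ k , fromℕ< r>0)

theorem4p1 : (k : ℕ) (r : Fin (suc k) → ℕ) → r zero ≡ 1 → 0 < r (fromℕ k) →
    Σ ℕ λ n → Σ (Graph (suc n)) λ G →
      Connected G × MuD≡ G k × DualVisSpectrum≡ G k r
theorem4p1 k r r0 r>0 = _ , G , connected , μd≡k , μd≡k , spectrum r0
  where
  open Spectrum k r
  μd≡k : MuD≡ G k
  μd≡k = largest-dmv k r r>0 , dmv-bounded
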